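{- It is not the case that NON-SPANNING CIRCUITS $\leq$ CIRCUITS; that is, there is no Turing machine running in time polynomial in its input length which, for every matroid $M$, given the rank of $M$ and the list of all non-spanning circuits of $M$ outputs the list of all circuits of $M$.
   Context: All matroids are finite. A matroid is described to a Turing machine by a list of subsets of its ground set $E$ ($|E| = n$), each subset encoded by its characteristic vector, with a reasonable encoding (no padding), so a description listing $i$ subsets has length $\Theta(ni)$. The NON-SPANNING CIRCUITS description consists of $r(M)$ and the list of all non-spanning circuits (only $r(M)$ if there are none). For two description types $I_1, I_2$, $I_1 \leq I_2$ means there is a polynomial-time Turing machine producing the $I_2$-description of $M$ from the $I_1$-description of $M$, for every matroid $M$. -}

module Defs where

open import Data.Nat using (ℕ; zero; suc; _+_; _*_; _^_; _<_; _≤_)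
open import Data.Bool using (Bool; true; false)
open import Data.Fin using (Fin; zero; suc)
open import Data.Fin.Subset using (Subset; _∈_; _⊆_; _∪_; _-_; ∣_∣; ⊥; ⊤)
open import Data.List using (List; []; _∷_; _++_; concat; map; replicate; length)
open import Data.Vec using (toList)
open import Data.Maybe using (Maybe; just; nothing)
open import Data.Product using (Σ; _×_; _,_; ∃)
open import Relation.Nullary using (¬_)
open import Relation.Binary.PropositionalEquality using (_≡_; _≢_)

-- Matroids on the ground set E = Fin n, given by their circuits
-- (circuit axioms C1–C3, Oxley).

record Matroid (n : ℕ) : Set₁ where
  field
    IsCircuit : Subset n → Set
    C1 : ¬ IsCircuit ⊥
    C2 : ∀ C D → IsCircuit C → IsCircuit D → D ⊆ C → D ≡ C
    C3 : ∀ C D (e : Fin n) → IsCircuit C → IsCircuit D → C ≢ D →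
         e ∈ C → e ∈ D →
         Σ (Subset n) λ F → IsCircuit F × F ⊆ ((C ∪ D) - e)

open Matroid public

Independent : ∀ {n} → Matroid n → Subset n → Set
Independent M X = ∀ C → IsCircuit M C → ¬ (C ⊆ X)

IsRankOf : ∀ {n} → Matroid n → Subset n → ℕ → Set
IsRankOf M X k =
  (Σ (Subset _) λ I → I ⊆ X × Independent M I × ∣ I ∣ ≡ k) ×
  (∀ I → I ⊆ X → Independent M I → ∣ I ∣ ≤ k)

IsRank : ∀ {n} → Matroid n → ℕ → Set
IsRank M k = IsRankOf M ⊤ k

NonSpanningCircuit : ∀ {n} → Matroid n → Subset n → Set
NonSpanningCircuit M C =
  IsCircuit M C × Σ ℕ λ k → Σ ℕ λ r → IsRankOf M C k × IsRank M r × k < r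

data _∈L_ {A : Set} (x : A) : List A → Set where
  here  : ∀ {xs} → x ∈L (x ∷ xs)
  there : ∀ {y xs} → x ∈L xs → x ∈L (y ∷ xs)

data NoDup {A : Set} : List A → Set where
  []  : NoDup []
  _∷_ : ∀ {x xs} → ¬ (x ∈L xs) → NoDup xs → NoDup (x ∷ xs)

Lists : ∀ {n} → (Subset n → Set) → List (Subset n) → Set
Lists P L = NoDup L × (∀ X → (X ∈L L → P X) × (P X → X ∈L L))

data Ch : Set where
  c0 c1 sep : Ch

charVec : ∀ {n} → Subset n → List Ch
charVec X = map (λ { true → c1 ; false → c0 }) (toList X)

encSubsets : ∀ {n} → List (Subset n) → List Ch
encSubsets L = concat (map (λ X → sep ∷ charVec X) L)

-- CIRCUITS description: ground set 1^n, then  #χ(C)  for each circuit C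
encCircuits : (n : ℕ) → List (Subset n) → List Ch
encCircuits n L = replicate n c1 ++ encSubsets L

-- NON-SPANNING CIRCUITS description: 1^n # 1^r(M), then #χ(C) for each
-- non-spanning circuit C
encNSC : (n : ℕ) → ℕ → List (Subset n) → List Ch
encNSC n r L = replicate n c1 ++ sep ∷ replicate r c1 ++ encSubsets L

-- Deterministic single-tape Turing machines (two-way infinite tape).
-- Tape alphabet Fin (4 + g): zero = blank, 1 = '0', 2 = '1', 3 = '#'.

data Move : Set where
  L R S : Move

record TM : Set where
  field
    nQ : ℕ      -- states are Fin (suc nQ); the start state is zero
    g  : ℕ      -- number of extra work symbols
    -- nothing = halt
    δ  : Fin (suc nQ) → Fin (4 + g) → Maybe (Fin (suc nQ) × Fin (4 + g) × Move)

open TM public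

Sym : TM → Set
Sym T = Fin (4 + g T)

record Config (T : TM) : Set where
  constructor cfg
  field
    state : Fin (suc (nQ T))
    left  : List (Sym T)   -- cells left of the head, nearest first
    right : List (Sym T)   -- head cell and cells to its right

open Config public

blank : ∀ {T} → Sym T
blank = zero

embed : ∀ {T} → Ch → Sym T
embed c0  = suc zero
embed c1  = suc (suc zero)
embed sep = suc (suc (suc zero))

readHead : ∀ {T} → Config T → Sym T
readHead {T} (cfg _ _ [])      = blank {T}
readHead (cfg _ _ (a ∷ _)) = a

tail' : ∀ {A : Set} → List A → List A
tail' []       = []
tail' (_ ∷ xs) = xs

apply : ∀ {T} → Fin (suc (nQ T)) × Sym T × Move → Config T → Config T
apply {T} (q , s , L) (cfg _ []      r) = cfg q [] (blank {T} ∷ s ∷ tail' r)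
apply (q , s , L) (cfg _ (a ∷ l) r) = cfg q l (a ∷ s ∷ tail' r)
apply (q , s , R) (cfg _ l       r) = cfg q (s ∷ l) (tail' r)
apply (q , s , S) (cfg _ l       r) = cfg q l (s ∷ tail' r)

run : (T : TM) → ℕ → Config T → Maybe (Config T)
run T t c with δ T (state c) (readHead c)
... | nothing = just c
run T zero    c | just _ = nothing
run T (suc t) c | just x = run T t (apply x c)

initial : (T : TM) → List Ch → Config T
initial T w = cfg zero [] (map (embed {T}) w)

output : ∀ {T} → Config T → List (Sym T)
output c = go (right c)
  where
  go : ∀ {A} → List (Fin (4 + A)) → List (Fin (4 + A))
  go []            = []
  go (zero ∷ _)    = []
  go (suc a ∷ xs)  = suc a ∷ go xs

PolyTimeNSCtoCircuits : TM → ℕ → ℕ → Set₁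
PolyTimeNSCtoCircuits T c d =
  ∀ n (M : Matroid n) (r : ℕ) (L : List (Subset n)) →
  IsRank M r → Lists (NonSpanningCircuit M) L →
  Σ (Config T) λ fin →
    run T (c * length (encNSC n r L) ^ d + c) (initial T (encNSC n r L)) ≡ just fin ×
    Σ (List (Subset n)) λ L' →
      Lists (IsCircuit M) L' × output fin ≡ map (embed {T}) (encCircuits n L')

-- The uniform matroid U(k, 2k+1) has rank k and no non-spanning circuits, so its
-- NON-SPANNING CIRCUITS description has length 3k+2, while it has at least 2^k
-- circuits (choose one element out of each of k disjoint pairs, plus a fixed extra
-- element). A Turing machine halting within t steps leaves at most 2t + |w| cells
-- of output, which is polynomial in k and hence eventually smaller than 2^k.
module Submission where

open import Defs
open import Data.Nat using (ℕ; zero; suc; _+_; _*_; _^_; _<_; _≤_; z≤n; s≤s; _≤?_)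
open import Data.Nat.Properties
open import Data.Nat.Tactic.RingSolver using (solve-∀)
open import Algebra.Properties.CommutativeSemigroup *-commutativeSemigroup using (interchange)
open import Data.Bool using (Bool; true; false; not)
open import Data.Fin using (Fin; zero; suc)
open import Data.Fin.Subset using (Subset; _∈_; _⊆_; _∪_; _-_; ∣_∣) renaming (⊥ to ∅)
open import Data.Fin.Subset.Properties
open import Data.Vec using (Vec; []; _∷_; here)
open import Data.List using (List; []; _∷_; length; map; replicate; _++_)
open import Data.List.Properties using (length-map; length-++; length-replicate; ++-identityʳ)
open import Data.Product using (Σ; ∃-syntax; _×_; _,_; proj₂)
open import Data.Maybe using (just; nothing)
open import Data.Empty using (⊥-elim)
open import Relation.Nullary using (¬_; yes; no)
open import Relation.Binary.PropositionalEquality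

open ≤-Reasoning

p⊆q∧∣q∣≤∣p∣⇒p≡q : ∀ {n} {p q : Subset n} → p ⊆ q → ∣ q ∣ ≤ ∣ p ∣ → p ≡ q
p⊆q∧∣q∣≤∣p∣⇒p≡q {p = []}        {[]}        _   _  = refl
p⊆q∧∣q∣≤∣p∣⇒p≡q {p = true ∷ p}  {true ∷ q}  p⊆q le =
  cong (true ∷_) (p⊆q∧∣q∣≤∣p∣⇒p≡q (drop-∷-⊆ p⊆q) (≤-pred le))
p⊆q∧∣q∣≤∣p∣⇒p≡q {p = false ∷ p} {false ∷ q} p⊆q le =
  cong (false ∷_) (p⊆q∧∣q∣≤∣p∣⇒p≡q (drop-∷-⊆ p⊆q) le)
p⊆q∧∣q∣≤∣p∣⇒p≡q {p = true ∷ p}  {false ∷ q} p⊆q le with p⊆q here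
... | ()
p⊆q∧∣q∣≤∣p∣⇒p≡q {p = false ∷ p} {true ∷ q}  p⊆q le =
  ⊥-elim (<⇒≱ le (p⊆q⇒∣p∣≤∣q∣ (drop-∷-⊆ p⊆q)))

∣p∣≡∣q∣∧p≢q⇒∣p∣<∣p∪q∣ : ∀ {n} {p q : Subset n} → ∣ p ∣ ≡ ∣ q ∣ → p ≢ q → ∣ p ∣ < ∣ p ∪ q ∣
∣p∣≡∣q∣∧p≢q⇒∣p∣<∣p∪q∣ {p = p} {q} ∣p∣≡∣q∣ p≢q with ∣ p ∪ q ∣ ≤? ∣ p ∣
... | no ∣p∪q∣≰∣p∣ = ≰⇒> ∣p∪q∣≰∣p∣
... | yes ∣p∪q∣≤∣p∣ = ⊥-elim (p≢q (sym (p⊆q∧∣q∣≤∣p∣⇒p≡q q⊆p (≤-reflexive ∣p∣≡∣q∣))))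
  where
  p≡p∪q : p ≡ p ∪ q
  p≡p∪q = p⊆q∧∣q∣≤∣p∣⇒p≡q (p⊆p∪q q) ∣p∪q∣≤∣p∣

  q⊆p : q ⊆ p
  q⊆p x∈q = subst (_ ∈_) (sym p≡p∪q) (q⊆p∪q p q x∈q)

∣p∣≤1+∣p-x∣ : ∀ {n} (p : Subset n) x → ∣ p ∣ ≤ suc ∣ p - x ∣
∣p∣≤1+∣p-x∣ (true ∷ p)  zero    = s≤s (≤-reflexive (cong ∣_∣ (sym (p─⊥≡p p))))
∣p∣≤1+∣p-x∣ (false ∷ p) zero    = ≤-trans (n≤1+n _) (s≤s (≤-reflexive (cong ∣_∣ (sym (p─⊥≡p p)))))
∣p∣≤1+∣p-x∣ (true ∷ p)  (suc x) = s≤s (∣p∣≤1+∣p-x∣ p x)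
∣p∣≤1+∣p-x∣ (false ∷ p) (suc x) = ∣p∣≤1+∣p-x∣ p x

⊆-ofSize : ∀ {n} (p : Subset n) m → m ≤ ∣ p ∣ → ∃[ q ] q ⊆ p × ∣ q ∣ ≡ m
⊆-ofSize {n} p       zero    _  = ∅ , ⊆-min p , ∣⊥∣≡0 n
⊆-ofSize (true ∷ p)  (suc m) le with ⊆-ofSize p m (≤-pred le)
... | q , q⊆p , ∣q∣≡m = true ∷ q , in⊆in q⊆p , cong suc ∣q∣≡m
⊆-ofSize (false ∷ p) (suc m) le with ⊆-ofSize p (suc m) le
... | q , q⊆p , ∣q∣≡m = false ∷ q , out⊆ q⊆p , ∣q∣≡m

IsRankOf-unique : ∀ {n} (M : Matroid n) {X a b} → IsRankOf M X a → IsRankOf M X b → a ≡ b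
IsRankOf-unique M ((I , I⊆X , indI , ∣I∣≡a) , maxA) ((J , J⊆X , indJ , ∣J∣≡b) , maxB) =
  ≤-antisym (subst (_≤ _) ∣I∣≡a (maxB I I⊆X indI)) (subst (_≤ _) ∣J∣≡b (maxA J J⊆X indJ))

uniform : ℕ → (n : ℕ) → Matroid n
uniform k n = record
  { IsCircuit = λ C → ∣ C ∣ ≡ suc k
  ; C1        = λ ∣∅∣≡1+k → 0≢1+n (trans (sym (∣⊥∣≡0 n)) ∣∅∣≡1+k)
  ; C2        = λ C D ∣C∣≡1+k ∣D∣≡1+k D⊆C →
                  p⊆q∧∣q∣≤∣p∣⇒p≡q D⊆C (≤-reflexive (trans ∣C∣≡1+k (sym ∣D∣≡1+k)))
  ; C3        = elimination
  }
  where
  elimination : ∀ C D (e : Fin n) → ∣ C ∣ ≡ suc k → ∣ D ∣ ≡ suc k → C ≢ D → e ∈ C → e ∈ D →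
                ∃[ F ] ∣ F ∣ ≡ suc k × F ⊆ (C ∪ D) - e
  elimination C D e ∣C∣≡1+k ∣D∣≡1+k C≢D _ _
    with ⊆-ofSize ((C ∪ D) - e) (suc k) (≤-pred (≤-trans 1+k<∣C∪D∣ (∣p∣≤1+∣p-x∣ (C ∪ D) e)))
    where
    1+k<∣C∪D∣ : suc k < ∣ C ∪ D ∣
    1+k<∣C∪D∣ = subst (_< ∣ C ∪ D ∣) ∣C∣≡1+k
                  (∣p∣≡∣q∣∧p≢q⇒∣p∣<∣p∪q∣ (trans ∣C∣≡1+k (sym ∣D∣≡1+k)) C≢D)
  ... | F , F⊆C∪D-e , ∣F∣≡1+k = F , ∣F∣≡1+k , F⊆C∪D-e

module _ {k n : ℕ} where

  uniform-independent⇒≤ : ∀ {I} → Independent (uniform k n) I → ∣ I ∣ ≤ k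
  uniform-independent⇒≤ {I} indI with ∣ I ∣ ≤? k
  ... | yes ∣I∣≤k = ∣I∣≤k
  ... | no ∣I∣≰k with ⊆-ofSize I (suc k) (≰⇒> ∣I∣≰k)
  ...   | C , C⊆I , ∣C∣≡1+k = ⊥-elim (indI C ∣C∣≡1+k C⊆I)

  ≤⇒uniform-independent : ∀ {I} → ∣ I ∣ ≤ k → Independent (uniform k n) I
  ≤⇒uniform-independent ∣I∣≤k C ∣C∣≡1+k C⊆I =
    ≤⇒≯ ∣I∣≤k (subst (_≤ _) ∣C∣≡1+k (p⊆q⇒∣p∣≤∣q∣ C⊆I))

  uniform-rankOf : ∀ {X} → k ≤ ∣ X ∣ → IsRankOf (uniform k n) X k
  uniform-rankOf {X} k≤∣X∣ with ⊆-ofSize X k k≤∣X∣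
  ... | I , I⊆X , ∣I∣≡k =
    (I , I⊆X , ≤⇒uniform-independent (≤-reflexive ∣I∣≡k) , ∣I∣≡k) ,
    λ J _ indJ → uniform-independent⇒≤ indJ

  uniform-rank : k ≤ n → IsRank (uniform k n) k
  uniform-rank k≤n = uniform-rankOf (subst (k ≤_) (sym (∣⊤∣≡n n)) k≤n)

  uniform-nonSpanningCircuit : ∀ {C} → ¬ NonSpanningCircuit (uniform k n) C
  uniform-nonSpanningCircuit {C} (∣C∣≡1+k , a , r , rC≡a , rM≡r , a<r) =
    <-irrefl (trans (IsRankOf-unique M rC≡a rC≡k) (IsRankOf-unique M rM≡k rM≡r)) a<r
    where
    M = uniform k n
    k≤∣C∣ : k ≤ ∣ C ∣
    k≤∣C∣ = subst (k ≤_) (sym ∣C∣≡1+k) (n≤1+n k)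
    rC≡k : IsRankOf M C k
    rC≡k = uniform-rankOf k≤∣C∣
    rM≡k : IsRank M k
    rM≡k = uniform-rankOf (≤-trans k≤∣C∣ (p⊆q⇒∣p∣≤∣q∣ (⊆⊤ {p = C})))

  uniform-lists-nonSpanningCircuits : Lists (NonSpanningCircuit (uniform k n)) []
  uniform-lists-nonSpanningCircuits =
    [] , λ X → (λ ()) , λ nsc → ⊥-elim (uniform-nonSpanningCircuit nsc)

tailsWithHead : ∀ {m} → Bool → List (Subset (suc m)) → List (Subset m)
tailsWithHead _     []                 = []
tailsWithHead true  ((true  ∷ p) ∷ ps) = p ∷ tailsWithHead true ps
tailsWithHead true  ((false ∷ _) ∷ ps) = tailsWithHead true ps
tailsWithHead false ((true  ∷ _) ∷ ps) = tailsWithHead false ps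
tailsWithHead false ((false ∷ p) ∷ ps) = p ∷ tailsWithHead false ps

length-tailsWithHead : ∀ {m} (ps : List (Subset (suc m))) →
  length (tailsWithHead true ps) + length (tailsWithHead false ps) ≡ length ps
length-tailsWithHead []                 = refl
length-tailsWithHead ((true  ∷ _) ∷ ps) = cong suc (length-tailsWithHead ps)
length-tailsWithHead ((false ∷ _) ∷ ps) = trans (+-suc _ _) (cong suc (length-tailsWithHead ps))

length-tailsWithHead-≤ : ∀ {m} b (ps : List (Subset (suc m))) →
  length (tailsWithHead b ps) ≤ length ps
length-tailsWithHead-≤ true  ps = ≤-trans (m≤m+n _ _) (≤-reflexive (length-tailsWithHead ps))
length-tailsWithHead-≤ false ps = ≤-trans (m≤n+m _ _) (≤-reflexive (length-tailsWithHead ps))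

∈-tailsWithHead : ∀ {m} b {p : Subset m} ps → (b ∷ p) ∈L ps → p ∈L tailsWithHead b ps
∈-tailsWithHead true  ((true  ∷ _) ∷ ps) here      = here
∈-tailsWithHead true  ((true  ∷ _) ∷ ps) (there q) = there (∈-tailsWithHead true ps q)
∈-tailsWithHead true  ((false ∷ _) ∷ ps) (there q) = ∈-tailsWithHead true ps q
∈-tailsWithHead false ((true  ∷ _) ∷ ps) (there q) = ∈-tailsWithHead false ps q
∈-tailsWithHead false ((false ∷ _) ∷ ps) here      = here
∈-tailsWithHead false ((false ∷ _) ∷ ps) (there q) = there (∈-tailsWithHead false ps q)

pairs : ∀ {k} → Vec Bool k → Subset (k * 2)
pairs []       = []
pairs (b ∷ bs) = b ∷ not b ∷ pairs bs

∣pairs∣ : ∀ {k} (bs : Vec Bool k) → ∣ pairs bs ∣ ≡ k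
∣pairs∣ []           = refl
∣pairs∣ (true  ∷ bs) = cong suc (∣pairs∣ bs)
∣pairs∣ (false ∷ bs) = cong suc (∣pairs∣ bs)

containing-pairs⇒2^k≤length : ∀ k (ps : List (Subset (k * 2))) →
                              (∀ (bs : Vec Bool k) → pairs bs ∈L ps) → 2 ^ k ≤ length ps
containing-pairs⇒2^k≤length zero ps ∋pairs with ∋pairs []
... | here    = s≤s z≤n
... | there _ = s≤s z≤n
containing-pairs⇒2^k≤length (suc k) ps ∋pairs = begin
  2 ^ k + (2 ^ k + 0)
    ≡⟨ cong (2 ^ k +_) (+-identityʳ (2 ^ k)) ⟩
  2 ^ k + 2 ^ k
    ≤⟨ +-mono-≤ (count true) (count false) ⟩
  length (tailsWithHead true ps) + length (tailsWithHead false ps)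
    ≡⟨ length-tailsWithHead ps ⟩
  length ps ∎
  where
  count : ∀ b → 2 ^ k ≤ length (tailsWithHead b ps)
  count b = ≤-trans
    (containing-pairs⇒2^k≤length k (tailsWithHead (not b) ps-b)
      (λ bs → ∈-tailsWithHead (not b) ps-b (∈-tailsWithHead b ps (∋pairs (b ∷ bs)))))
    (length-tailsWithHead-≤ (not b) ps-b)
    where
    ps-b = tailsWithHead b ps

uniform-circuits-length : ∀ k {Cs} → Lists (IsCircuit (uniform k (suc (k * 2)))) Cs → 2 ^ k ≤ length Cs
uniform-circuits-length k {Cs} (_ , lists) =
  ≤-trans (containing-pairs⇒2^k≤length k (tailsWithHead true Cs) ∋pairs)
          (length-tailsWithHead-≤ true Cs)
  where
  ∋pairs : ∀ bs → pairs bs ∈L tailsWithHead true Cs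
  ∋pairs bs = ∈-tailsWithHead true Cs (proj₂ (lists (true ∷ pairs bs)) (cong suc (∣pairs∣ bs)))

length-tail' : ∀ {A : Set} (xs : List A) → length (tail' xs) ≤ length xs
length-tail' []       = z≤n
length-tail' (_ ∷ xs) = n≤1+n (length xs)

length-right-apply : ∀ {T} x (c : Config T) → length (right (apply x c)) ≤ 2 + length (right c)
length-right-apply (_ , _ , L) (cfg _ []      r) = s≤s (s≤s (length-tail' r))
length-right-apply (_ , _ , L) (cfg _ (_ ∷ _) r) = s≤s (s≤s (length-tail' r))
length-right-apply (_ , _ , R) (cfg _ _       r) = ≤-trans (length-tail' r) (m≤n+m _ 2)
length-right-apply (_ , _ , S) (cfg _ _       r) = s≤s (≤-trans (length-tail' r) (n≤1+n _))

length-right-run : ∀ T t (c : Config T) {fin} → run T t c ≡ just fin →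
                   length (right fin) ≤ t * 2 + length (right c)
length-right-run T t c halts with δ T (state c) (readHead c)
length-right-run T t       c       refl  | nothing = m≤n+m _ (t * 2)
length-right-run T (suc t) c {fin} halts | just x  = begin
  length (right fin)                 ≤⟨ length-right-run T t (apply x c) halts ⟩
  t * 2 + length (right (apply x c)) ≤⟨ +-monoʳ-≤ (t * 2) (length-right-apply x c) ⟩
  t * 2 + (2 + length (right c))     ≡⟨ sym (+-assoc (t * 2) 2 _) ⟩
  t * 2 + 2 + length (right c)       ≡⟨ cong (_+ length (right c)) (+-comm (t * 2) 2) ⟩
  suc t * 2 + length (right c)       ∎

length-output : ∀ {T} (c : Config T) → length (output c) ≤ length (right c)
length-output     (cfg _ _ [])           = z≤n
length-output     (cfg _ _ (zero  ∷ _))  = z≤n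
length-output {T} (cfg q l (suc _ ∷ xs)) = s≤s (length-output {T} (cfg q l xs))

length-output-run : ∀ T t w {fin} → run T t (initial T w) ≡ just fin →
                    length (output fin) ≤ t * 2 + length w
length-output-run T t w {fin} halts = begin
  length (output fin)                  ≤⟨ length-output fin ⟩
  length (right fin)                   ≤⟨ length-right-run T t (initial T w) halts ⟩
  t * 2 + length (map (embed {T}) w)   ≡⟨ cong (t * 2 +_) (length-map (embed {T}) w) ⟩
  t * 2 + length w                     ∎

length-encCircuits : ∀ n (Xs : List (Subset n)) → length Xs ≤ length (encCircuits n Xs)
length-encCircuits n Xs = begin
  length Xs                                        ≤⟨ length-encSubsets Xs ⟩
  length (encSubsets Xs)                           ≤⟨ m≤n+m _ _ ⟩
  length (replicate n c1) + length (encSubsets Xs) ≡⟨ sym (length-++ (replicate n c1)) ⟩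
  length (encCircuits n Xs)                        ∎
  where
  length-encSubsets : ∀ {n} (Xs : List (Subset n)) → length Xs ≤ length (encSubsets Xs)
  length-encSubsets []       = z≤n
  length-encSubsets (X ∷ Xs) =
    s≤s (≤-trans (length-encSubsets Xs) (≤-trans (m≤n+m _ _) (≤-reflexive (sym (length-++ (charVec X))))))

length-encNSC-[] : ∀ n r → length (encNSC n r []) ≡ n + suc r
length-encNSC-[] n r = begin-equality
  length (replicate n c1 ++ sep ∷ replicate r c1 ++ [])
    ≡⟨ length-++ (replicate n c1) ⟩
  length (replicate n c1) + suc (length (replicate r c1 ++ []))
    ≡⟨ cong₂ (λ a b → a + suc (length b)) (length-replicate n) (++-identityʳ (replicate r c1)) ⟩
  n + suc (length (replicate r c1))
    ≡⟨ cong (λ b → n + suc b) (length-replicate r) ⟩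
  n + suc r ∎

tapeBound : ℕ → ℕ → ℕ → ℕ
tapeBound c d x = (c * x ^ d + c) * 2 + x

circuits-length-≤-tapeBound : ∀ T c d → PolyTimeNSCtoCircuits T c d →
  ∀ n (M : Matroid n) r NSCs → IsRank M r → Lists (NonSpanningCircuit M) NSCs →
  ∃[ Cs ] Lists (IsCircuit M) Cs × length Cs ≤ tapeBound c d (length (encNSC n r NSCs))
circuits-length-≤-tapeBound T c d converts n M r NSCs rM≡r lists
  with converts n M r NSCs rM≡r lists
... | fin , halts , Cs , listsCs , output≡ = Cs , listsCs , (begin
  length Cs                                   ≤⟨ length-encCircuits n Cs ⟩
  length (encCircuits n Cs)                   ≡⟨ sym (length-map (embed {T}) (encCircuits n Cs)) ⟩
  length (map (embed {T}) (encCircuits n Cs)) ≡⟨ cong length (sym output≡) ⟩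
  length (output fin)                         ≤⟨ length-output-run T _ (encNSC n r NSCs) halts ⟩
  tapeBound c d (length (encNSC n r NSCs))    ∎)

tapeBound-mono : ∀ c d {x y} → x ≤ y → tapeBound c d x ≤ tapeBound c d y
tapeBound-mono c d x≤y = +-mono-≤ (*-monoˡ-≤ 2 (+-monoˡ-≤ c (*-monoʳ-≤ c (^-monoˡ-≤ d x≤y)))) x≤y

tapeBound-poly : ∀ c d x → tapeBound c d (suc x) ≤ suc (c * 4) * suc x ^ suc d
tapeBound-poly c d x = begin
  (c * y ^ d + c) * 2 + y ≤⟨ +-mono-≤ (*-monoˡ-≤ 2 (+-mono-≤ (*-monoʳ-≤ c y^d≤P) c≤cP)) y≤P ⟩
  (c * P + c * P) * 2 + P ≡⟨ collect c P ⟩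
  suc (c * 4) * P         ∎
  where
  y = suc x
  P = y ^ suc d
  y^d≤P : y ^ d ≤ P
  y^d≤P = m≤n*m (y ^ d) y
  c≤cP : c ≤ c * P
  c≤cP = m≤m*n c P {{m^n≢0 y (suc d)}}
  y≤P : y ≤ P
  y≤P = m≤m*n y (y ^ d) {{m^n≢0 y d}}
  collect : ∀ a b → (a * b + a * b) * 2 + b ≡ suc (a * 4) * b
  collect = solve-∀

n<2^n : ∀ n → n < 2 ^ n
n<2^n zero    = s≤s z≤n
n<2^n (suc n) = begin-strict
  1 + n         <⟨ +-mono-≤-< (m^n>0 2 n) (n<2^n n) ⟩
  2 ^ n + 2 ^ n ≡⟨ cong (2 ^ n +_) (sym (+-identityʳ (2 ^ n))) ⟩
  2 ^ suc n     ∎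

-- Take j = 2m with m = 1 + a + 2b: then a + jb < m (1 + 2b) ≤ m² < (2^m)² = 2^j.
linear<exp : ∀ a b → ∃[ j ] a + j * b < 2 ^ j
linear<exp a b = m + m , (begin-strict
  a + (m + m) * b   ≡⟨ cong (a +_) (regroup m b) ⟩
  a + m * (2 * b)   <⟨ +-monoˡ-< (m * (2 * b)) (s≤s (m≤m+n a (2 * b))) ⟩
  m + m * (2 * b)   ≡⟨ sym (*-suc m (2 * b)) ⟩
  m * suc (2 * b)   ≤⟨ *-monoʳ-≤ m (s≤s (m≤n+m (2 * b) a)) ⟩
  m * m             <⟨ *-mono-< (n<2^n m) (n<2^n m) ⟩
  2 ^ m * 2 ^ m     ≡⟨ sym (^-distribˡ-+-* 2 m m) ⟩
  2 ^ (m + m)       ∎)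
  where
  m = suc (a + 2 * b)
  regroup : ∀ x y → (x + x) * y ≡ x * (2 * y)
  regroup = solve-∀

^-distribʳ-* : ∀ m n p → (m * n) ^ p ≡ m ^ p * n ^ p
^-distribʳ-* m n zero    = refl
^-distribʳ-* m n (suc p) =
  trans (cong (m * n *_) (^-distribʳ-* m n p)) (interchange m n (m ^ p) (n ^ p))

-- Taking k = 2^j turns the polynomial a (1 + k)^d into a power of two.
exp-beats-poly : ∀ a d → ∃[ k ] a * suc k ^ d < 2 ^ k
exp-beats-poly a d with linear<exp (a + d) d
... | j , small = 2 ^ j , (begin-strict
  a * suc (2 ^ j) ^ d     ≤⟨ *-mono-≤ (<⇒≤ (n<2^n a)) (^-monoˡ-≤ d 1+2^j≤2^[1+j]) ⟩
  2 ^ a * (2 ^ suc j) ^ d ≡⟨ cong (2 ^ a *_) (^-*-assoc 2 (suc j) d) ⟩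
  2 ^ a * 2 ^ (suc j * d) ≡⟨ sym (^-distribˡ-+-* 2 a (suc j * d)) ⟩
  2 ^ (a + suc j * d)     ≡⟨ cong (2 ^_) (sym (+-assoc a d (j * d))) ⟩
  2 ^ (a + d + j * d)     <⟨ ^-monoʳ-< 2 (s≤s (s≤s z≤n)) small ⟩
  2 ^ 2 ^ j               ∎)
  where
  1+2^j≤2^[1+j] : suc (2 ^ j) ≤ 2 ^ suc j
  1+2^j≤2^[1+j] = begin
    suc (2 ^ j)         ≡⟨ +-comm 1 (2 ^ j) ⟩
    2 ^ j + 1           ≤⟨ +-monoʳ-≤ (2 ^ j) (≤-trans (m^n>0 2 j) (m≤m+n (2 ^ j) 0)) ⟩
    2 ^ j + (2 ^ j + 0) ∎

input-length : ∀ k → length (encNSC (suc (k * 2)) k []) ≤ 3 * suc k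
input-length k = begin
  length (encNSC (suc (k * 2)) k []) ≡⟨ length-encNSC-[] (suc (k * 2)) k ⟩
  suc (k * 2) + suc k               ≤⟨ n≤1+n _ ⟩
  suc (suc (k * 2) + suc k)         ≡⟨ count k ⟩
  3 * suc k                         ∎
  where
  count : ∀ m → suc (suc (m * 2) + suc m) ≡ 3 * suc m
  count = solve-∀

lemma17 : ¬ (Σ TM λ T → Σ ℕ λ c → Σ ℕ λ d → PolyTimeNSCtoCircuits T c d)
lemma17 (T , c , d , converts) =
  let k , poly<2^k = exp-beats-poly (suc (c * 4) * 3 ^ suc d) (suc d)
      n = suc (k * 2)
      Cs , circuits , Cs≤tapeBound =
        circuits-length-≤-tapeBound T c d converts n (uniform k n) k []
          (uniform-rank (≤-trans (m≤m*n k 2) (n≤1+n (k * 2))))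
          (uniform-lists-nonSpanningCircuits {k} {n})
  in <⇒≱ poly<2^k (begin
    2 ^ k                                     ≤⟨ uniform-circuits-length k circuits ⟩
    length Cs                                 ≤⟨ Cs≤tapeBound ⟩
    tapeBound c d (length (encNSC n k []))    ≤⟨ tapeBound-mono c d (input-length k) ⟩
    tapeBound c d (3 * suc k)                 ≤⟨ tapeBound-poly c d _ ⟩
    suc (c * 4) * (3 * suc k) ^ suc d         ≡⟨ cong (suc (c * 4) *_) (^-distribʳ-* 3 (suc k) (suc d)) ⟩
    suc (c * 4) * (3 ^ suc d * suc k ^ suc d) ≡⟨ sym (*-assoc (suc (c * 4)) (3 ^ suc d) _) ⟩
    suc (c * 4) * 3 ^ suc d * suc k ^ suc d   ∎)
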